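{- Let $k \ge 3$ and $n \ge 1$ be integers, and let $M = (M_{i_1,\ldots,i_k})_{i_1,\ldots,i_k=1}^n$ be a cubical complex hypermatrix of order $k$ and dimension $n$ such that $M_{i_1,\ldots,i_k} = 0$ whenever $|\{i_1,\ldots,i_k\}| < k$. Then the hyperdeterminant of $M$ is $0$.
   Context: A cubical hypermatrix of order $k$ and dimension $n$ is an array $M=(M_{i_1,\ldots,i_k})$ indexed by $[n]^k$. An entry $M_{i_1,\ldots,i_k}$ is called degenerate if $|\{i_1,\ldots,i_k\}|<k$. The hyperdeterminant of $M$ (in the sense of Gelfand–Kapranov–Zelevinsky) is a polynomial in the entries of $M$ which vanishes if and only if there is a nonzero $x \in \mathbb{C}^n$ with $\nabla f_M(x) = \vec 0$, where $f_M(x_1,\ldots,x_n) = \sum_{i_1,\ldots,i_k} M_{i_1,\ldots,i_k} \prod_{j=1}^k x_{i_j}$. -}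

module Defs where

open import Level using (Level)
open import Data.Nat using (ℕ; zero; suc; _≥_; _<_)
open import Data.Fin using (Fin; zero; suc; _≟_)
open import Data.Product using (∃; ∃-syntax; _×_)
open import Relation.Nullary using (¬_; yes; no)
open import Relation.Binary.PropositionalEquality using (_≡_; _≢_)
open import Algebra.Bundles using (CommutativeRing)

module _ {c ℓ : Level} (R : CommutativeRing c ℓ) where
  open CommutativeRing R hiding (zero)

  sumFin : (n : ℕ) → (Fin n → Carrier) → Carrier
  sumFin zero    f = 0#
  sumFin (suc n) f = f zero + sumFin n (λ i → f (suc i))

  prodFin : (n : ℕ) → (Fin n → Carrier) → Carrier
  prodFin zero    f = 1#
  prodFin (suc n) f = f zero * prodFin n (λ i → f (suc i))

  sumTuples : (k n : ℕ) → ((Fin k → Fin n) → Carrier) → Carrier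
  sumTuples zero    n f = f (λ ())
  sumTuples (suc k) n f =
    sumFin n (λ i → sumTuples k n (λ t → f (λ { zero → i ; (suc p) → t p })))

  Hypermatrix : ℕ → ℕ → Set c
  Hypermatrix k n = (Fin k → Fin n) → Carrier

  formM : {k n : ℕ} → Hypermatrix k n → (Fin n → Carrier) → Carrier
  formM {k} {n} M x = sumTuples k n (λ t → M t * prodFin k (λ q → x (t q)))

  -- ∂ f_M / ∂ x_j (x) = Σ_{i₁..i_k} M_{i₁..i_k} Σ_p [i_p = j] Π_{q ≠ p} x_{i_q}
  -- (formal partial derivative, product rule applied to each monomial)
  partialM : {k n : ℕ} → Hypermatrix k n → Fin n → (Fin n → Carrier) → Carrier
  partialM {k} {n} M j x =
    sumTuples k n (λ t → M t * sumFin k (λ p → term t p))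
    where
      term : (Fin k → Fin n) → Fin k → Carrier
      term t p with t p ≟ j
      ... | no  _ = 0#
      ... | yes _ = prodFin k (λ q → other t p q)
        where
          other : (Fin k → Fin n) → Fin k → Fin k → Carrier
          other t p q with q ≟ p
          ... | yes _ = 1#
          ... | no  _ = x (t q)

  GradientVanishes : {k n : ℕ} → Hypermatrix k n → (Fin n → Carrier) → Set ℓ
  GradientVanishes M x = ∀ j → partialM M j x ≈ 0#

  NonzeroVec : {n : ℕ} → (Fin n → Carrier) → Set ℓ
  NonzeroVec {n} x = ∃[ i ] ¬ (x i ≈ 0#)

  -- "Det(M) = 0", via the GKZ characterization given in the context:
  -- there is a nonzero x with ∇ f_M (x) = 0.
  HyperdetVanishes : {k n : ℕ} → Hypermatrix k n → Set (c Level.⊔ ℓ)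
  HyperdetVanishes {k} {n} M = ∃[ x ] (NonzeroVec {n} x × GradientVanishes M x)

-- an index tuple is degenerate iff |{i₁,…,i_k}| < k, i.e. two positions coincide
Degenerate : {k n : ℕ} → (Fin k → Fin n) → Set
Degenerate {k} t = ∃[ p ] ∃[ q ] (p ≢ q × t p ≡ t q)

-- At the first standard basis vector e₀ a monomial M_t ∏_{q ≠ p} x_{t q} of
-- ∂f_M/∂x_j survives only if all k - 1 indices t q with q ≠ p equal 0. For k ≥ 3
-- two of them then coincide, so t is degenerate and M_t = 0. Hence ∇f_M(e₀) = 0
-- with e₀ ≠ 0.
module Submission where

open import Defs
open import Level using (Level)
open import Data.Nat as ℕ using (ℕ; _≥_; suc; s≤s)
open import Data.Fin using (Fin; zero; suc; _≟_)
open import Data.Product using (_,_; _×_; ∃₂)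
open import Data.Sum using (_⊎_; inj₁; inj₂)
open import Data.Empty using (⊥-elim)
open import Relation.Nullary using (¬_; yes; no)
open import Relation.Binary.PropositionalEquality as ≡ using (_≡_; _≢_)
open import Algebra.Bundles using (CommutativeRing)

two-other-positions : ∀ {k} → k ≥ 3 → (p : Fin k) → ∃₂ λ a b → a ≢ b × a ≢ p × b ≢ p
two-other-positions (s≤s (s≤s (s≤s _))) zero          = suc zero , suc (suc zero) , (λ ()) , (λ ()) , (λ ())
two-other-positions (s≤s (s≤s (s≤s _))) (suc zero)    = zero , suc (suc zero) , (λ ()) , (λ ()) , (λ ())
two-other-positions (s≤s (s≤s (s≤s _))) (suc (suc _)) = zero , suc zero , (λ ()) , (λ ()) , (λ ())

module _ {c ℓ : Level} (R : CommutativeRing c ℓ) where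
  open CommutativeRing R hiding (zero)

  x≈0⇒x*y≈0 : ∀ {x} y → x ≈ 0# → x * y ≈ 0#
  x≈0⇒x*y≈0 y x≈0 = trans (*-congʳ x≈0) (zeroˡ y)

  x≈0⇒y*x≈0 : ∀ {x} y → x ≈ 0# → y * x ≈ 0#
  x≈0⇒y*x≈0 y x≈0 = trans (*-congˡ x≈0) (zeroʳ y)

  sumFin-zero : ∀ n {f : Fin n → Carrier} → (∀ i → f i ≈ 0#) → sumFin R n f ≈ 0#
  sumFin-zero ℕ.zero  f≈0 = refl
  sumFin-zero (suc n) f≈0 =
    trans (+-cong (f≈0 zero) (sumFin-zero n (λ i → f≈0 (suc i)))) (+-identityˡ 0#)

  sumTuples-zero : ∀ k n {f : (Fin k → Fin n) → Carrier} →
                   (∀ t → f t ≈ 0#) → sumTuples R k n f ≈ 0#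
  sumTuples-zero ℕ.zero  n f≈0 = f≈0 _
  sumTuples-zero (suc k) n f≈0 = sumFin-zero n (λ i → sumTuples-zero k n (λ t → f≈0 _))

  *-distribˡ-sumFin : ∀ n a {f : Fin n → Carrier} →
                      a * sumFin R n f ≈ sumFin R n (λ i → a * f i)
  *-distribˡ-sumFin ℕ.zero  a = zeroʳ a
  *-distribˡ-sumFin (suc n) a = trans (distribˡ a _ _) (+-congˡ (*-distribˡ-sumFin n a))

  prodFin-zero : ∀ n {f : Fin n → Carrier} (i : Fin n) → f i ≈ 0# → prodFin R n f ≈ 0#
  prodFin-zero (suc n) zero    fi≈0 = x≈0⇒x*y≈0 _ fi≈0
  prodFin-zero (suc n) (suc i) fi≈0 = x≈0⇒y*x≈0 _ (prodFin-zero n i fi≈0)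

  SupportedAt : ∀ {n} → (Fin n → Carrier) → Fin n → Set ℓ
  SupportedAt x z = ∀ i → i ≢ z → x i ≈ 0#

  e₀ : ∀ {n} → Fin (suc n) → Carrier
  e₀ zero    = 1#
  e₀ (suc _) = 0#

  e₀-supportedAt-zero : ∀ {n} → SupportedAt (e₀ {n}) zero
  e₀-supportedAt-zero zero    i≢0 = ⊥-elim (i≢0 ≡.refl)
  e₀-supportedAt-zero (suc i) _   = refl

  degenerate-or-off-support : ∀ {k n} {x : Fin n → Carrier} {z : Fin n} →
    SupportedAt x z → (t : Fin k → Fin n) (a b : Fin k) → a ≢ b →
    Degenerate t ⊎ x (t a) ≈ 0# ⊎ x (t b) ≈ 0#
  degenerate-or-off-support {z = z} x-supp t a b a≢b with t a ≟ z | t b ≟ z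
  ... | yes ta≡z | yes tb≡z = inj₁ (a , b , a≢b , ≡.trans ta≡z (≡.sym tb≡z))
  ... | no  ta≢z | _        = inj₂ (inj₁ (x-supp (t a) ta≢z))
  ... | yes _    | no  tb≢z = inj₂ (inj₂ (x-supp (t b) tb≢z))

  module _ {k n} (k≥3 : k ≥ 3) (M : Hypermatrix R k n) (M-deg : ∀ t → Degenerate t → M t ≈ 0#)
           {x : Fin n → Carrier} {z : Fin n} (x-supp : SupportedAt x z) (j : Fin n) where

    -- The summand of partialM and its factor `other` are local to the definition
    -- of partialM and cannot be named: the types below leave them as metas, solved
    -- by the uses, which are checked before the defining clauses. `other` depends
    -- on the proof of t p ≡ j, whence that otherwise unused argument; it must be
    -- bound by name, since a meta cannot depend on a non-dependent arrow's domain.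
    summand-vanishes : (t : Fin k → Fin n) (p : Fin k) → M t * _ ≈ 0#
    factor-off-p : (t : Fin k → Fin n) (p : Fin k) (tp≡j : t p ≡ j) (a : Fin k) →
                   a ≢ p → _ ≈ x (t a)

    partialM-vanishes-at-supportedAt : partialM R M j x ≈ 0#
    partialM-vanishes-at-supportedAt =
      sumTuples-zero k n λ t →
        trans (*-distribˡ-sumFin k (M t)) (sumFin-zero k (summand-vanishes t))

    summand-vanishes t p with t p ≟ j
    ... | no _ = zeroʳ (M t)
    ... | yes tp≡j with two-other-positions k≥3 p
    ...   | a , b , a≢b , a≢p , b≢p with degenerate-or-off-support x-supp t a b a≢b
    ...     | inj₁ deg          = x≈0⇒x*y≈0 _ (M-deg t deg)
    ...     | inj₂ (inj₁ xta≈0) =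
      x≈0⇒y*x≈0 (M t) (prodFin-zero k a (trans (factor-off-p t p tp≡j a a≢p) xta≈0))
    ...     | inj₂ (inj₂ xtb≈0) =
      x≈0⇒y*x≈0 (M t) (prodFin-zero k b (trans (factor-off-p t p tp≡j b b≢p) xtb≈0))

    factor-off-p t p _ a a≢p with a ≟ p
    ... | yes a≡p = ⊥-elim (a≢p a≡p)
    ... | no  _   = refl

mainTheorem1 : {c ℓ : Level} (R : CommutativeRing c ℓ)
    → ¬ (CommutativeRing._≈_ R (CommutativeRing.1# R) (CommutativeRing.0# R))
    → (k n : ℕ) → k ≥ 3 → n ≥ 1
    → (M : Hypermatrix R k n)
    → (∀ (t : Fin k → Fin n) → Degenerate t → CommutativeRing._≈_ R (M t) (CommutativeRing.0# R))
    → HyperdetVanishes R M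
mainTheorem1 R 1≉0 k (suc n) k≥3 (s≤s _) M M-deg =
  e₀ R , (zero , 1≉0) , partialM-vanishes-at-supportedAt R k≥3 M M-deg (e₀-supportedAt-zero R)
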